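{- For every integer $n\ge 4$, the tent $T_n$ satisfies $\Theta(T_n)=3$.
   Context: The tent $T_n$ is the graph on $n+1$ vertices obtained from the path $P_n$ on $n$ vertices by adding one new vertex adjacent to every vertex of the path. For an integer $k\ge 0$, a graph $G=(V,E)$ is a $k$-threshold graph with thresholds $\theta_1<\dots<\theta_k$ if there is $r:V\to\mathbb{R}$ such that for any two distinct $u,v\in V$, $uv\in E$ if and only if $r(u)+r(v)\ge\theta_i$ for an odd number of indices $i\in\{1,\dots,k\}$. The threshold number $\Theta(G)$ is the smallest $k\ge 0$ such that $G$ is a $k$-threshold graph.
   Formalization: The rank function r and the thresholds take values in ℚ instead of ℝ. -}

module Defs where

open import Data.Nat using (ℕ; zero; suc; _<_)
open import Data.Fin using (Fin; toℕ) renaming (zero to fzero; suc to fsuc)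
open import Data.Rational using (ℚ; _+_; _≤_) renaming (_<_ to _<ℚ_)
open import Data.Product using (Σ; _×_)
open import Data.Sum using (_⊎_)
open import Relation.Nullary using (¬_; yes; no)
open import Relation.Binary.PropositionalEquality using (_≡_)
open import Function.Bundles using (_⇔_)
open import Data.Rational.Properties using (_≤?_)
open import Level using (0ℓ)

-- A (simple, loopless) graph on the vertex set Fin m, given by its adjacency
-- relation (only consulted on pairs of distinct vertices).
record Graph (m : ℕ) : Set₁ where
  field
    Adj : Fin m → Fin m → Set

data Odd : ℕ → Set where
  odd-one : Odd 1
  odd-ss  : ∀ {n} → Odd n → Odd (suc (suc n))

countLe : (k : ℕ) → (Fin k → ℚ) → ℚ → ℕ
countLe zero    θ x = 0
countLe (suc k) θ x with θ fzero ≤? x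
... | yes _ = suc (countLe k (λ i → θ (fsuc i)) x)
... | no  _ = countLe k (λ i → θ (fsuc i)) x

StrictlyIncreasing : (k : ℕ) → (Fin k → ℚ) → Set
StrictlyIncreasing k θ = ∀ (i j : Fin k) → toℕ i < toℕ j → θ i <ℚ θ j

IsKThreshold : ∀ {m} → ℕ → Graph m → Set
IsKThreshold {m} k G =
  Σ (Fin k → ℚ) λ θ → StrictlyIncreasing k θ ×
  Σ (Fin m → ℚ) λ r →
    ∀ (u v : Fin m) → ¬ (u ≡ v) →
      Graph.Adj G u v ⇔ Odd (countLe k θ (r u + r v))

ThresholdNumber≡ : ∀ {m} → Graph m → ℕ → Set
ThresholdNumber≡ G k = IsKThreshold k G × (∀ j → j < k → ¬ IsKThreshold j G)

-- The tent T_n on vertices Fin (n+1): vertices 0..n-1 form the path P_n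
-- (i ~ i+1), vertex n is the apex adjacent to all path vertices.
Tent : (n : ℕ) → Graph (suc n)
Tent n = record
  { Adj = λ u v → (toℕ u ≡ n) ⊎ (toℕ v ≡ n) ⊎ (suc (toℕ u) ≡ toℕ v) ⊎ (suc (toℕ v) ≡ toℕ u) }

-- Give path vertex k the rank (-1)^k k. Two path ranks sum to ±1 when the vertices are
-- consecutive and to at least 2 in absolute value otherwise, so with the apex ranked far above
-- everything the thresholds -1 < 2 < 2n + 3 represent T_n.
--
-- Conversely, path vertices 0, 1, 2, 3 and the apex induce a gem. With one threshold, the edges
-- 01, 23 and the non-edges 02, 13 have rank sums with the same total, which is impossible when
-- the former reach the threshold and the latter do not. With two, the edges are the sums in a
-- window; a non-edge below it has both ends ranked below the apex and one above it both ends
-- above the apex, so the non-edges 02, 03, 13 lie on one side of the window, and the same total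
-- argument applies.
module Submission where

open import Defs
open import Data.Nat using (ℕ; _≤_)

open import Algebra.Bundles using (CommutativeMonoid)
open import Data.Empty using (⊥; ⊥-elim)
open import Data.Fin using (Fin; toℕ; fromℕ; #_) renaming (zero to fzero; suc to fsuc)
open import Data.Fin.Properties using (toℕ-fromℕ; toℕ-injective; toℕ≤pred[n])
open import Data.Integer as ℤ using (ℤ; +_; -[1+_]; 1ℤ; -1ℤ; ∣_∣; +≤+; -≤+; -≤-; +<+; -<+)
import Data.Integer.Properties as ℤ
open import Data.Integer.Tactic.RingSolver using (solve-∀)
open import Data.Nat as ℕ using (zero; suc; s≤s; z≤n; ∣_-_∣)
import Data.Nat.Properties as ℕ
open import Data.Product as Product using (_×_; _,_)
open import Data.Rational as ℚ using (ℚ; *≤*; *<*; _/_)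
open import Data.Rational.Literals using (fromℤ)
import Data.Rational.Properties as ℚ
open import Data.Sum as Sum using (_⊎_; inj₁; inj₂; [_,_])
open import Function using (_∘_; id)
open import Function.Bundles using (_⇔_; mk⇔; Equivalence)
open import Function.Properties.Equivalence using () renaming (sym to ⇔-sym; trans to ⇔-trans)
open import Relation.Nullary using (¬_; yes; no; contradiction)
open import Relation.Binary.PropositionalEquality using (_≡_; _≢_; refl; sym; trans; cong; cong₂; subst; subst₂; module ≡-Reasoning)

open import Algebra.Properties.CommutativeSemigroup (CommutativeMonoid.commutativeSemigroup ℚ.+-0-commutativeMonoid) using (interchange)
open import Algebra.Properties.Group ℚ.+-0-group using (//-rightDividesʳ)

Represents : ∀ {m k} → Graph m → (Fin k → ℚ) → (Fin m → ℚ) → Set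
Represents {m} {k} G θ r =
  ∀ (u v : Fin m) → ¬ (u ≡ v) → Graph.Adj G u v ⇔ Odd (countLe k θ (r u ℚ.+ r v))

<⇒≱ : ∀ {p q : ℚ} → p ℚ.< q → ¬ (q ℚ.≤ p)
<⇒≱ p<q q≤p = ℚ.<-irrefl refl (ℚ.<-≤-trans p<q q≤p)

¬Odd-0 : ¬ Odd 0
¬Odd-0 ()

countLe-below : ∀ {k} (θ : Fin k → ℚ) {x} → (∀ i → x ℚ.< θ i) → countLe k θ x ≡ 0
countLe-below {zero}  θ x<θ = refl
countLe-below {suc k} θ {x} x<θ with θ fzero ℚ.≤? x
... | yes θ₀≤x = contradiction θ₀≤x (<⇒≱ (x<θ fzero))
... | no  _    = countLe-below (θ ∘ fsuc) (x<θ ∘ fsuc)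

below-later : ∀ {k} {θ : Fin k → ℚ} → StrictlyIncreasing k θ →
              ∀ {x i j} → x ℚ.< θ i → toℕ i ℕ.≤ toℕ j → x ℚ.< θ j
below-later {θ = θ} θ-inc {x} x<θᵢ i≤j with ℕ.m≤n⇒m<n∨m≡n i≤j
... | inj₁ i<j = ℚ.<-trans x<θᵢ (θ-inc _ _ i<j)
... | inj₂ i≡j = subst (λ j → x ℚ.< θ j) (toℕ-injective i≡j) x<θᵢ

Odd-countLe₁ : ∀ (θ : Fin 1 → ℚ) x → Odd (countLe 1 θ x) ⇔ θ (# 0) ℚ.≤ x
Odd-countLe₁ θ x with θ (# 0) ℚ.≤? x
... | yes θ₀≤x = mk⇔ (λ _ → θ₀≤x) (λ _ → odd-one)
... | no  θ₀≰x = mk⇔ (λ ()) (λ θ₀≤x → contradiction θ₀≤x θ₀≰x)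

Odd-countLe₂ : ∀ (θ : Fin 2 → ℚ) → StrictlyIncreasing 2 θ → ∀ x →
               Odd (countLe 2 θ x) ⇔ (θ (# 0) ℚ.≤ x × x ℚ.< θ (# 1))
Odd-countLe₂ θ θ-inc x with θ (# 0) ℚ.≤? x
... | no θ₀≰x =
  mk⇔ (⊥-elim ∘ ¬Odd-0 ∘ subst Odd (countLe-below (θ ∘ fsuc) (x<θ ∘ fsuc)))
      (λ (θ₀≤x , _) → contradiction θ₀≤x θ₀≰x)
  where
  x<θ : ∀ i → x ℚ.< θ i
  x<θ _ = below-later θ-inc (ℚ.≰⇒> θ₀≰x) z≤n
... | yes θ₀≤x with θ (# 1) ℚ.≤? x
...   | yes θ₁≤x = mk⇔ (λ { (odd-ss ()) }) (λ (_ , x<θ₁) → contradiction θ₁≤x (<⇒≱ x<θ₁))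
...   | no  θ₁≰x = mk⇔ (λ _ → θ₀≤x , ℚ.≰⇒> θ₁≰x) (λ _ → odd-one)

Odd-countLe₃ : ∀ (θ : Fin 3 → ℚ) → StrictlyIncreasing 3 θ → ∀ x →
               Odd (countLe 3 θ x) ⇔ ((θ (# 0) ℚ.≤ x × x ℚ.< θ (# 1)) ⊎ θ (# 2) ℚ.≤ x)
Odd-countLe₃ θ θ-inc x with θ (# 0) ℚ.≤? x
... | no θ₀≰x =
  mk⇔ (⊥-elim ∘ ¬Odd-0 ∘ subst Odd (countLe-below (θ ∘ fsuc) (x<θ ∘ fsuc)))
      [ (λ (θ₀≤x , _) → contradiction θ₀≤x θ₀≰x) , (λ θ₂≤x → contradiction θ₂≤x (<⇒≱ (x<θ (# 2)))) ]
  where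
  x<θ : ∀ i → x ℚ.< θ i
  x<θ _ = below-later θ-inc (ℚ.≰⇒> θ₀≰x) z≤n
... | yes θ₀≤x with θ (# 1) ℚ.≤? x
...   | no θ₁≰x =
  mk⇔ (λ _ → inj₁ (θ₀≤x , x<θ₁)) (λ _ → subst (Odd ∘ suc) (sym rest≡0) odd-one)
  where
  x<θ₁ : x ℚ.< θ (# 1)
  x<θ₁ = ℚ.≰⇒> θ₁≰x
  rest≡0 : countLe 1 (θ ∘ fsuc ∘ fsuc) x ≡ 0
  rest≡0 = countLe-below (θ ∘ fsuc ∘ fsuc) (λ _ → below-later θ-inc x<θ₁ (s≤s z≤n))
...   | yes θ₁≤x with θ (# 2) ℚ.≤? x
...     | yes θ₂≤x = mk⇔ (λ _ → inj₂ θ₂≤x) (λ _ → odd-ss odd-one)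
...     | no  θ₂≰x =
  mk⇔ (λ { (odd-ss ()) })
      [ (λ (_ , x<θ₁) → contradiction θ₁≤x (<⇒≱ x<θ₁)) , (λ θ₂≤x → contradiction θ₂≤x θ₂≰x) ]

+-cancelʳ-< : ∀ z {x y : ℚ} → x ℚ.+ z ℚ.< y ℚ.+ z → x ℚ.< y
+-cancelʳ-< z {x} {y} x+z<y+z =
  subst₂ ℚ._<_ (//-rightDividesʳ z x) (//-rightDividesʳ z y) (ℚ.+-monoˡ-< (ℚ.- z) x+z<y+z)

+-cancelˡ-< : ∀ z {x y : ℚ} → z ℚ.+ x ℚ.< z ℚ.+ y → x ℚ.< y
+-cancelˡ-< z {x} {y} = +-cancelʳ-< z ∘ subst₂ ℚ._<_ (ℚ.+-comm z x) (ℚ.+-comm z y)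

outside-interval : ∀ {a b x : ℚ} → ¬ (a ℚ.≤ x × x ℚ.< b) → x ℚ.< a ⊎ b ℚ.≤ x
outside-interval {a} {b} {x} ¬a≤x<b with a ℚ.≤? x
... | no  a≰x = inj₁ (ℚ.≰⇒> a≰x)
... | yes a≤x = inj₂ (ℚ.≮⇒≥ (λ x<b → ¬a≤x<b (a≤x , x<b)))

no-alternating-4-cycle : ∀ {θ : ℚ} a b c d →
  θ ℚ.≤ a ℚ.+ b → θ ℚ.≤ c ℚ.+ d → a ℚ.+ c ℚ.< θ → b ℚ.+ d ℚ.< θ → ⊥
no-alternating-4-cycle {θ} a b c d θ≤a+b θ≤c+d a+c<θ b+d<θ = ℚ.<-irrefl refl (begin-strict
  (a ℚ.+ c) ℚ.+ (b ℚ.+ d)  <⟨ ℚ.+-mono-< a+c<θ b+d<θ ⟩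
  θ ℚ.+ θ                  ≤⟨ ℚ.+-mono-≤ θ≤a+b θ≤c+d ⟩
  (a ℚ.+ b) ℚ.+ (c ℚ.+ d)  ≡⟨ interchange a b c d ⟩
  (a ℚ.+ c) ℚ.+ (b ℚ.+ d)  ∎)
  where open ℚ.≤-Reasoning

fromℤ-mono-≤ : ∀ {i j} → i ℤ.≤ j → fromℤ i ℚ.≤ fromℤ j
fromℤ-mono-≤ {i} {j} = *≤* ∘ subst₂ ℤ._≤_ (sym (ℤ.*-identityʳ i)) (sym (ℤ.*-identityʳ j))

fromℤ-cancel-≤ : ∀ {i j} → fromℤ i ℚ.≤ fromℤ j → i ℤ.≤ j
fromℤ-cancel-≤ {i} {j} (*≤* i≤j) = subst₂ ℤ._≤_ (ℤ.*-identityʳ i) (ℤ.*-identityʳ j) i≤j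

fromℤ-mono-< : ∀ {i j} → i ℤ.< j → fromℤ i ℚ.< fromℤ j
fromℤ-mono-< {i} {j} = *<* ∘ subst₂ ℤ._<_ (sym (ℤ.*-identityʳ i)) (sym (ℤ.*-identityʳ j))

fromℤ-cancel-< : ∀ {i j} → fromℤ i ℚ.< fromℤ j → i ℤ.< j
fromℤ-cancel-< {i} {j} (*<* i<j) = subst₂ ℤ._<_ (ℤ.*-identityʳ i) (ℤ.*-identityʳ j) i<j

fromℤ-homo-+ : ∀ i j → fromℤ (i ℤ.+ j) ≡ fromℤ i ℚ.+ fromℤ j
fromℤ-homo-+ i j = begin
  fromℤ (i ℤ.+ j)                   ≡⟨ ℚ.↥p/↧p≡p (fromℤ (i ℤ.+ j)) ⟨
  (i ℤ.+ j) / 1                     ≡⟨ cong (_/ 1) (cong₂ ℤ._+_ (ℤ.*-identityʳ i) (ℤ.*-identityʳ j)) ⟨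
  (i ℤ.* + 1 ℤ.+ j ℤ.* + 1) / 1     ≡⟨⟩
  fromℤ i ℚ.+ fromℤ j               ∎
  where open ≡-Reasoning

fromℤ-band : ∀ a b c x →
  ((fromℤ a ℚ.≤ fromℤ x × fromℤ x ℚ.< fromℤ b) ⊎ fromℤ c ℚ.≤ fromℤ x) ⇔ ((a ℤ.≤ x × x ℤ.< b) ⊎ c ℤ.≤ x)
fromℤ-band _ _ _ _ = mk⇔
  (Sum.map (Product.map fromℤ-cancel-≤ fromℤ-cancel-<) fromℤ-cancel-≤)
  (Sum.map (Product.map fromℤ-mono-≤ fromℤ-mono-<) fromℤ-mono-≤)

-1^n≡1⊎-1^n≡-1 : ∀ n → -1ℤ ℤ.^ n ≡ 1ℤ ⊎ -1ℤ ℤ.^ n ≡ -1ℤ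
-1^n≡1⊎-1^n≡-1 zero = inj₁ refl
-1^n≡1⊎-1^n≡-1 (suc n) with -1^n≡1⊎-1^n≡-1 n
... | inj₁ -1^n≡1  rewrite -1^n≡1  = inj₂ refl
... | inj₂ -1^n≡-1 rewrite -1^n≡-1 = inj₁ refl

∣-1^n*i∣≡∣i∣ : ∀ n i → ∣ -1ℤ ℤ.^ n ℤ.* i ∣ ≡ ∣ i ∣
∣-1^n*i∣≡∣i∣ n i with -1^n≡1⊎-1^n≡-1 n
... | inj₁ -1^n≡1  rewrite -1^n≡1  = cong ∣_∣ (ℤ.*-identityˡ i)
... | inj₂ -1^n≡-1 rewrite -1^n≡-1 = trans (cong ∣_∣ (ℤ.-1*i≡-i i)) (ℤ.∣-i∣≡∣i∣ i)

pathRank : ℕ → ℤ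
pathRank k = -1ℤ ℤ.^ k ℤ.* + k

∣pathRank∣ : ∀ k → ∣ pathRank k ∣ ≡ k
∣pathRank∣ k = ∣-1^n*i∣≡∣i∣ k (+ k)

∣pathRank+pathRank∣≤ : ∀ i j → ∣ pathRank i ℤ.+ pathRank j ∣ ≤ i ℕ.+ j
∣pathRank+pathRank∣≤ i j =
  subst (∣ pathRank i ℤ.+ pathRank j ∣ ≤_) (cong₂ ℕ._+_ (∣pathRank∣ i) (∣pathRank∣ j))
        (ℤ.∣i+j∣≤∣i∣+∣j∣ (pathRank i) (pathRank j))

pathRank-consecutive : ∀ i → ∣ pathRank i ℤ.+ pathRank (suc i) ∣ ≡ 1
pathRank-consecutive i = begin
  ∣ pathRank i ℤ.+ pathRank (suc i) ∣  ≡⟨ cong ∣_∣ (factor (-1ℤ ℤ.^ i) (+ i)) ⟩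
  ∣ -1ℤ ℤ.^ i ℤ.* -1ℤ ∣                ≡⟨ ∣-1^n*i∣≡∣i∣ i -1ℤ ⟩
  1                                    ∎
  where
  open ≡-Reasoning
  factor : ∀ s x → s ℤ.* x ℤ.+ (-1ℤ ℤ.* s) ℤ.* (1ℤ ℤ.+ x) ≡ s ℤ.* -1ℤ
  factor = solve-∀

-- Writing j = i + d and factoring out (-1)^i, the sum is ±(2i + d) for even d and ±d for odd d.
pathRank-gap : ∀ {i j} → i ≤ j → ∣ i - j ∣ ≤ ∣ pathRank i ℤ.+ pathRank j ∣
pathRank-gap {i} i≤j with ℕ.m≤n⇒∃[o]m+o≡n i≤j
... | d , refl = subst₂ _≤_ (sym (ℕ.∣m-m+n∣≡n i d)) (sym ∣sum∣) (gap (-1^n≡1⊎-1^n≡-1 d))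
  where
  open ≡-Reasoning
  s t : ℤ
  s = -1ℤ ℤ.^ i
  t = -1ℤ ℤ.^ d
  factor : ∀ a b x y → a ℤ.* x ℤ.+ (a ℤ.* b) ℤ.* (x ℤ.+ y) ≡ a ℤ.* (x ℤ.+ b ℤ.* (x ℤ.+ y))
  factor = solve-∀
  ∣sum∣ : ∣ pathRank i ℤ.+ pathRank (i ℕ.+ d) ∣ ≡ ∣ + i ℤ.+ t ℤ.* (+ i ℤ.+ + d) ∣
  ∣sum∣ = begin
    ∣ pathRank i ℤ.+ pathRank (i ℕ.+ d) ∣
      ≡⟨ cong (λ y → ∣ pathRank i ℤ.+ y ∣) (cong₂ ℤ._*_ (ℤ.^-distribˡ-+-* -1ℤ i d) (ℤ.pos-+ i d)) ⟩
    ∣ s ℤ.* + i ℤ.+ (s ℤ.* t) ℤ.* (+ i ℤ.+ + d) ∣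
      ≡⟨ cong ∣_∣ (factor s t (+ i) (+ d)) ⟩
    ∣ s ℤ.* (+ i ℤ.+ t ℤ.* (+ i ℤ.+ + d)) ∣
      ≡⟨ ∣-1^n*i∣≡∣i∣ i _ ⟩
    ∣ + i ℤ.+ t ℤ.* (+ i ℤ.+ + d) ∣
      ∎
  cancel : ∀ x y → x ℤ.+ -1ℤ ℤ.* (x ℤ.+ y) ≡ ℤ.- y
  cancel = solve-∀
  gap : ∀ {σ} → σ ≡ 1ℤ ⊎ σ ≡ -1ℤ → d ≤ ∣ + i ℤ.+ σ ℤ.* (+ i ℤ.+ + d) ∣
  gap (inj₁ refl) rewrite ℤ.*-identityˡ (+ i ℤ.+ + d) = ℕ.≤-trans (ℕ.m≤n+m d i) (ℕ.m≤n+m (i ℕ.+ d) i)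
  gap (inj₂ refl) rewrite cancel (+ i) (+ d) = ℕ.≤-reflexive (sym (ℤ.∣-i∣≡∣i∣ (+ d)))

∣i-j∣≤∣pathRank+pathRank∣ : ∀ i j → ∣ i - j ∣ ≤ ∣ pathRank i ℤ.+ pathRank j ∣
∣i-j∣≤∣pathRank+pathRank∣ i j with ℕ.≤-total i j
... | inj₁ i≤j = pathRank-gap i≤j
... | inj₂ j≤i =
  subst₂ _≤_ (ℕ.∣-∣-comm j i) (cong ∣_∣ (ℤ.+-comm (pathRank j) (pathRank i))) (pathRank-gap j≤i)

Consecutive : ℕ → ℕ → Set
Consecutive i j = suc i ≡ j ⊎ suc j ≡ i

∣i-j∣≤1⇒Consecutive : ∀ {i j} → i ≢ j → ∣ i - j ∣ ≤ 1 → Consecutive i j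
∣i-j∣≤1⇒Consecutive {zero}        {zero}        0≢0 _ = contradiction refl 0≢0
∣i-j∣≤1⇒Consecutive {zero}        {suc zero}    _ _ = inj₁ refl
∣i-j∣≤1⇒Consecutive {zero}        {suc (suc j)} _ (s≤s ())
∣i-j∣≤1⇒Consecutive {suc zero}    {zero}        _ _ = inj₂ refl
∣i-j∣≤1⇒Consecutive {suc (suc i)} {zero}        _ (s≤s ())
∣i-j∣≤1⇒Consecutive {suc i}       {suc j}       i≢j ∣i-j∣≤1 =
  Sum.map (cong suc) (cong suc) (∣i-j∣≤1⇒Consecutive (i≢j ∘ cong suc) ∣i-j∣≤1)

∣pathRank+pathRank∣≤1⇔Consecutive : ∀ {i j} → i ≢ j →
  ∣ pathRank i ℤ.+ pathRank j ∣ ≤ 1 ⇔ Consecutive i j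
∣pathRank+pathRank∣≤1⇔Consecutive {i} {j} i≢j =
  mk⇔ (∣i-j∣≤1⇒Consecutive i≢j ∘ ℕ.≤-trans (∣i-j∣≤∣pathRank+pathRank∣ i j)) consecutive⇒≤1
  where
  consecutive⇒≤1 : Consecutive i j → ∣ pathRank i ℤ.+ pathRank j ∣ ≤ 1
  consecutive⇒≤1 (inj₁ refl) = ℕ.≤-reflexive (pathRank-consecutive i)
  consecutive⇒≤1 (inj₂ refl) =
    ℕ.≤-reflexive (trans (cong ∣_∣ (ℤ.+-comm (pathRank i) (pathRank j))) (pathRank-consecutive j))

window⇔∣∣≤1 : ∀ {m} s → ∣ s ∣ ℕ.< m → ((-1ℤ ℤ.≤ s × s ℤ.< + 2) ⊎ + m ℤ.≤ s) ⇔ ∣ s ∣ ≤ 1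
window⇔∣∣≤1 (+ k) k<m = mk⇔
  [ (λ { (_ , +<+ (s≤s k≤1)) → k≤1 }) , (λ { (+≤+ m≤k) → contradiction k<m (ℕ.≤⇒≯ m≤k) }) ]
  (λ k≤1 → inj₁ (-≤+ , +<+ (s≤s k≤1)))
window⇔∣∣≤1 -[1+ k ] _ = mk⇔
  [ (λ { (-≤- k≤0 , _) → s≤s k≤0 }) , (λ ()) ]
  (λ { (s≤s k≤0) → inj₁ (-≤- k≤0 , -<+) })

+m≤+[m+n]+i : ∀ m {n} i → ∣ i ∣ ≤ n → + m ℤ.≤ + (m ℕ.+ n) ℤ.+ i
+m≤+[m+n]+i m {n} (+ k) _ = +≤+ (ℕ.≤-trans (ℕ.m≤m+n m n) (ℕ.m≤m+n (m ℕ.+ n) k))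
+m≤+[m+n]+i m {n} -[1+ k ] k<n = begin
  + m                       ≤⟨ +≤+ (ℕ.m≤m+n m (n ℕ.∸ suc k)) ⟩
  + (m ℕ.+ (n ℕ.∸ suc k))   ≡⟨ cong +_ (ℕ.+-∸-assoc m k<n) ⟨
  + (m ℕ.+ n ℕ.∸ suc k)     ≡⟨ ℤ.⊖-≥ (ℕ.≤-trans k<n (ℕ.m≤n+m n m)) ⟨
  (m ℕ.+ n) ℤ.⊖ suc k       ∎
  where open ℤ.≤-Reasoning

-- Path sums stay below the top threshold, as |pathRank i + pathRank j| ≤ i + j ≤ 2n, while the
-- apex rank exceeds it by n ≥ |pathRank k|, so every apex sum reaches it.
topThreshold : ℕ → ℕ
topThreshold n = 3 ℕ.+ (n ℕ.+ n)

tentRank : ℕ → ℕ → ℤ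
tentRank n k with k ℕ.≟ n
... | yes _ = + (topThreshold n ℕ.+ n)
... | no  _ = pathRank k

TentAdjacent : ℕ → ℕ → ℕ → Set
TentAdjacent n i j = i ≡ n ⊎ j ≡ n ⊎ Consecutive i j

apex+pathRank : ∀ n {k} → k ≤ n → + topThreshold n ℤ.≤ + (topThreshold n ℕ.+ n) ℤ.+ pathRank k
apex+pathRank n {k} k≤n =
  +m≤+[m+n]+i (topThreshold n) (pathRank k) (subst (_≤ n) (sym (∣pathRank∣ k)) k≤n)

TentAdjacent⇔tentRank-band : ∀ {n i j} → i ≤ n → j ≤ n → i ≢ j →
  let s = tentRank n i ℤ.+ tentRank n j in
  TentAdjacent n i j ⇔ ((-1ℤ ℤ.≤ s × s ℤ.< + 2) ⊎ + topThreshold n ℤ.≤ s)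
TentAdjacent⇔tentRank-band {n} {i} {j} i≤n j≤n i≢j with i ℕ.≟ n | j ℕ.≟ n
... | yes i≡n | yes j≡n = contradiction (trans i≡n (sym j≡n)) i≢j
... | yes i≡n | no  _   = mk⇔ (λ _ → inj₂ (apex+pathRank n j≤n)) (λ _ → inj₁ i≡n)
... | no  _   | yes j≡n =
  mk⇔ (λ _ → inj₂ (subst (+ topThreshold n ℤ.≤_) (ℤ.+-comm _ (pathRank i)) (apex+pathRank n i≤n)))
      (λ _ → inj₂ (inj₁ j≡n))
... | no  i≢n | no  j≢n =
  ⇔-trans drop-apex
  (⇔-trans (⇔-sym (∣pathRank+pathRank∣≤1⇔Consecutive i≢j))
           (⇔-sym (window⇔∣∣≤1 _ sum<top)))
  where
  drop-apex : TentAdjacent n i j ⇔ Consecutive i j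
  drop-apex = mk⇔ [ ⊥-elim ∘ i≢n , [ ⊥-elim ∘ j≢n , id ] ] (inj₂ ∘ inj₂)
  sum<top : ∣ pathRank i ℤ.+ pathRank j ∣ ℕ.< topThreshold n
  sum<top = ℕ.≤-<-trans (∣pathRank+pathRank∣≤ i j)
              (ℕ.≤-<-trans (ℕ.+-mono-≤ i≤n j≤n) (ℕ.m<n+m (n ℕ.+ n) {3} (s≤s z≤n)))

tentThresholds : ℕ → Fin 3 → ℚ
tentThresholds n fzero               = fromℤ -1ℤ
tentThresholds n (fsuc fzero)        = fromℤ (+ 2)
tentThresholds n (fsuc (fsuc fzero)) = fromℤ (+ topThreshold n)

tentThresholds-increasing : ∀ n → StrictlyIncreasing 3 (tentThresholds n)
tentThresholds-increasing n fzero               (fsuc fzero)        _ = fromℤ-mono-< -<+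
tentThresholds-increasing n fzero               (fsuc (fsuc fzero)) _ = fromℤ-mono-< -<+
tentThresholds-increasing n (fsuc fzero)        (fsuc (fsuc fzero)) _ =
  fromℤ-mono-< (+<+ (s≤s (s≤s (s≤s z≤n))))
tentThresholds-increasing n _                   fzero               ()
tentThresholds-increasing n (fsuc fzero)        (fsuc fzero)        (s≤s ())
tentThresholds-increasing n (fsuc (fsuc fzero)) (fsuc fzero)        (s≤s ())
tentThresholds-increasing n (fsuc (fsuc fzero)) (fsuc (fsuc fzero)) (s≤s (s≤s ()))

Tent-is-3-threshold : ∀ n → IsKThreshold 3 (Tent n)
Tent-is-3-threshold n = tentThresholds n , tentThresholds-increasing n , r , represents
  where
  r : Fin (suc n) → ℚ
  r u = fromℤ (tentRank n (toℕ u))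
  represents : Represents (Tent n) (tentThresholds n) r
  represents u v u≢v =
    ⇔-trans (TentAdjacent⇔tentRank-band (toℕ≤pred[n] u) (toℕ≤pred[n] v) (u≢v ∘ toℕ-injective))
    (⇔-trans (⇔-sym (fromℤ-band -1ℤ (+ 2) (+ topThreshold n) (a ℤ.+ b)))
    (⇔-trans (⇔-sym (Odd-countLe₃ (tentThresholds n) (tentThresholds-increasing n) (fromℤ (a ℤ.+ b))))
    (mk⇔ (subst OddCount (fromℤ-homo-+ a b)) (subst OddCount (sym (fromℤ-homo-+ a b))))))
    where
    a b : ℤ
    a = tentRank n (toℕ u)
    b = tentRank n (toℕ v)
    OddCount : ℚ → Set
    OddCount x = Odd (countLe 3 (tentThresholds n) x)

module _ (m : ℕ) where
  private
    n : ℕ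
    n = 4 ℕ.+ m
    apex p₀ p₁ p₂ p₃ : Fin (suc n)
    apex = fromℕ n
    p₀ = # 0
    p₁ = # 1
    p₂ = # 2
    p₃ = # 3

  private module Gem {k : ℕ} (θ : Fin k → ℚ) (r : Fin (suc n) → ℚ) (rep : Represents (Tent n) θ r) where
    OddSum : Fin (suc n) → Fin (suc n) → Set
    OddSum u v = Odd (countLe k θ (r u ℚ.+ r v))

    edge : ∀ u v → u ≢ v → Graph.Adj (Tent n) u v → OddSum u v
    edge u v u≢v = Equivalence.to (rep u v u≢v)

    non-edge : ∀ u v → u ≢ v → ¬ Graph.Adj (Tent n) u v → ¬ OddSum u v
    non-edge u v u≢v ¬uv = ¬uv ∘ Equivalence.from (rep u v u≢v)

    odd₀₁ : OddSum p₀ p₁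
    odd₀₁ = edge p₀ p₁ (λ ()) (inj₂ (inj₂ (inj₁ refl)))

    odd₂₃ : OddSum p₂ p₃
    odd₂₃ = edge p₂ p₃ (λ ()) (inj₂ (inj₂ (inj₁ refl)))

    odd-apexˡ : ∀ u → apex ≢ u → OddSum apex u
    odd-apexˡ u apex≢u = edge apex u apex≢u (inj₁ (toℕ-fromℕ n))

    odd-apexʳ : ∀ u → u ≢ apex → OddSum u apex
    odd-apexʳ u u≢apex = edge u apex u≢apex (inj₂ (inj₁ (toℕ-fromℕ n)))

    even₀₂ : ¬ OddSum p₀ p₂
    even₀₂ = non-edge p₀ p₂ (λ ())
      (λ { (inj₁ ()) ; (inj₂ (inj₁ ())) ; (inj₂ (inj₂ (inj₁ ()))) ; (inj₂ (inj₂ (inj₂ ()))) })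

    even₁₃ : ¬ OddSum p₁ p₃
    even₁₃ = non-edge p₁ p₃ (λ ())
      (λ { (inj₁ ()) ; (inj₂ (inj₁ ())) ; (inj₂ (inj₂ (inj₁ ()))) ; (inj₂ (inj₂ (inj₂ ()))) })

    even₀₃ : ¬ OddSum p₀ p₃
    even₀₃ = non-edge p₀ p₃ (λ ())
      (λ { (inj₁ ()) ; (inj₂ (inj₁ ())) ; (inj₂ (inj₂ (inj₁ ()))) ; (inj₂ (inj₂ (inj₂ ()))) })

  Tent-not-0-threshold : ¬ IsKThreshold 0 (Tent (4 ℕ.+ m))
  Tent-not-0-threshold (θ , _ , r , rep) = ¬Odd-0 (Gem.odd₀₁ θ r rep)

  Tent-not-1-threshold : ¬ IsKThreshold 1 (Tent (4 ℕ.+ m))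
  Tent-not-1-threshold (θ , _ , r , rep) =
    no-alternating-4-cycle (r p₀) (r p₁) (r p₂) (r p₃)
      (above odd₀₁) (above odd₂₃) (below even₀₂) (below even₁₃)
    where
    open Gem θ r rep
    above : ∀ {x} → Odd (countLe 1 θ x) → θ (# 0) ℚ.≤ x
    above {x} = Equivalence.to (Odd-countLe₁ θ x)
    below : ∀ {x} → ¬ Odd (countLe 1 θ x) → x ℚ.< θ (# 0)
    below {x} ¬odd = ℚ.≰⇒> (¬odd ∘ Equivalence.from (Odd-countLe₁ θ x))

  Tent-not-2-threshold : ¬ IsKThreshold 2 (Tent (4 ℕ.+ m))
  Tent-not-2-threshold (θ , θ-inc , r , rep) =
    sides (outside even₀₂) (outside even₁₃) (outside even₀₃)
    where
    open Gem θ r rep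
    θ₀ θ₁ : ℚ
    θ₀ = θ (# 0)
    θ₁ = θ (# 1)
    lo : ∀ {x} → Odd (countLe 2 θ x) → θ₀ ℚ.≤ x
    lo {x} = Product.proj₁ ∘ Equivalence.to (Odd-countLe₂ θ θ-inc x)
    hi : ∀ {x} → Odd (countLe 2 θ x) → x ℚ.< θ₁
    hi {x} = Product.proj₂ ∘ Equivalence.to (Odd-countLe₂ θ θ-inc x)
    outside : ∀ {x} → ¬ Odd (countLe 2 θ x) → x ℚ.< θ₀ ⊎ θ₁ ℚ.≤ x
    outside {x} ¬odd = outside-interval (¬odd ∘ Equivalence.from (Odd-countLe₂ θ θ-inc x))
    belowʳ : ∀ x v → apex ≢ v → x ℚ.+ r v ℚ.< θ₀ → x ℚ.< r apex
    belowʳ x v apex≢v x+v<θ₀ = +-cancelʳ-< (r v) (ℚ.<-≤-trans x+v<θ₀ (lo (odd-apexˡ v apex≢v)))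
    aboveʳ : ∀ x v → apex ≢ v → θ₁ ℚ.≤ x ℚ.+ r v → r apex ℚ.< x
    aboveʳ x v apex≢v θ₁≤x+v = +-cancelʳ-< (r v) (ℚ.<-≤-trans (hi (odd-apexˡ v apex≢v)) θ₁≤x+v)
    belowˡ : ∀ u x → u ≢ apex → r u ℚ.+ x ℚ.< θ₀ → x ℚ.< r apex
    belowˡ u x u≢apex u+x<θ₀ = +-cancelˡ-< (r u) (ℚ.<-≤-trans u+x<θ₀ (lo (odd-apexʳ u u≢apex)))
    aboveˡ : ∀ u x → u ≢ apex → θ₁ ℚ.≤ r u ℚ.+ x → r apex ℚ.< x
    aboveˡ u x u≢apex θ₁≤u+x = +-cancelˡ-< (r u) (ℚ.<-≤-trans (hi (odd-apexʳ u u≢apex)) θ₁≤u+x)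
    sides : r p₀ ℚ.+ r p₂ ℚ.< θ₀ ⊎ θ₁ ℚ.≤ r p₀ ℚ.+ r p₂ →
            r p₁ ℚ.+ r p₃ ℚ.< θ₀ ⊎ θ₁ ℚ.≤ r p₁ ℚ.+ r p₃ →
            r p₀ ℚ.+ r p₃ ℚ.< θ₀ ⊎ θ₁ ℚ.≤ r p₀ ℚ.+ r p₃ → ⊥
    sides (inj₁ low₀₂) (inj₁ low₁₃) _ =
      no-alternating-4-cycle (r p₀) (r p₁) (r p₂) (r p₃) (lo odd₀₁) (lo odd₂₃) low₀₂ low₁₃
    sides (inj₂ high₀₂) (inj₂ high₁₃) _ =
      no-alternating-4-cycle (r p₀) (r p₂) (r p₁) (r p₃) high₀₂ high₁₃ (hi odd₀₁) (hi odd₂₃)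
    sides (inj₁ low₀₂) (inj₂ high₁₃) (inj₁ low₀₃) =
      ℚ.<-asym (belowˡ p₀ (r p₃) (λ ()) low₀₃) (aboveˡ p₁ (r p₃) (λ ()) high₁₃)
    sides (inj₁ low₀₂) (inj₂ high₁₃) (inj₂ high₀₃) =
      ℚ.<-asym (belowʳ (r p₀) p₂ (λ ()) low₀₂) (aboveʳ (r p₀) p₃ (λ ()) high₀₃)
    sides (inj₂ high₀₂) (inj₁ low₁₃) (inj₁ low₀₃) =
      ℚ.<-asym (belowʳ (r p₀) p₃ (λ ()) low₀₃) (aboveʳ (r p₀) p₂ (λ ()) high₀₂)
    sides (inj₂ high₀₂) (inj₁ low₁₃) (inj₂ high₀₃) =
      ℚ.<-asym (belowˡ p₁ (r p₃) (λ ()) low₁₃) (aboveˡ p₀ (r p₃) (λ ()) high₀₃)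

  Tent-not-below-3-threshold : ∀ k → k ℕ.< 3 → ¬ IsKThreshold k (Tent (4 ℕ.+ m))
  Tent-not-below-3-threshold 0 _ = Tent-not-0-threshold
  Tent-not-below-3-threshold 1 _ = Tent-not-1-threshold
  Tent-not-below-3-threshold 2 _ = Tent-not-2-threshold
  Tent-not-below-3-threshold (suc (suc (suc _))) (s≤s (s≤s (s≤s ())))

mainTheorem5 : (n : ℕ) → 4 ≤ n → ThresholdNumber≡ (Tent n) 3
mainTheorem5 n 4≤n with ℕ.m≤n⇒∃[o]m+o≡n 4≤n
... | m , refl = Tent-is-3-threshold (4 ℕ.+ m) , Tent-not-below-3-threshold m
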